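{- Let $A$ and $B$ be two FDDS, let $\alpha$ be the number of unroll trees of $\mathcal{U}(B)$, and let $n\ge 2\alpha+\mathrm{depth}(\mathcal{U}(B))$. Then $\mathcal{U}(A)=\mathcal{U}(B)$ if and only if $[\mathcal{U}(A)]_n=[\mathcal{U}(B)]_n$.
   Context: A finite discrete-time dynamical system (FDDS) is a pair $(S,f)$ with $S$ finite and $f:S\to S$, considered up to isomorphism. A state is periodic if it lies on a cycle. The depth of an FDDS is the maximum over states $s$ of the least $t\ge0$ with $f^t(s)$ periodic. For a periodic state $u$, the unroll tree in $u$ is the infinite rooted tree with vertex set $\{(s,k)\mid k\in\mathbb{N},\ f^k(s)=u\}$, root $(u,0)$ and arcs $(v,k)\to(f(v),k-1)$. The unroll $\mathcal{U}(A)$ is the multiset of unroll trees of $A$ (one per periodic state), and $\mathrm{depth}(\mathcal{U}(A))=\mathrm{depth}(A)$. The depth of a node is its distance to the root; $[\mathbf{t}]_n$ is the induced subtree on vertices of depth at most $n$, applied treewise to multisets. Equality means isomorphism of multisets of rooted trees. -}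

module Defs where

open import Data.Nat using (ℕ; zero; suc; _≤_; _<_; z≤n)
open import Data.Fin using (Fin)
open import Data.Product using (Σ; ∃-syntax; _×_; _,_; proj₁; proj₂)
open import Function.Bundles using (_↔_; Inverse; _⇔_)
open import Relation.Binary.PropositionalEquality using (_≡_; refl)
open import Relation.Nullary using (¬_)

record FDDS : Set where
  constructor fdds
  field
    size : ℕ
    f    : Fin size → Fin size
open FDDS public

State : FDDS → Set
State A = Fin (size A)

iter : {X : Set} → (X → X) → ℕ → X → X
iter g zero    x = x
iter g (suc k) x = g (iter g k x)

Periodic : (A : FDDS) → State A → Set
Periodic A s = ∃[ k ] iter (f A) (suc k) s ≡ s

-- a periodic state (the periodicity witness is irrelevant, so each periodic
-- state occurs exactly once)
record PeriodicState (A : FDDS) : Set where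
  constructor pstate
  field
    state       : State A
    .isPeriodic : Periodic A state
open PeriodicState public

-- d is the depth of A: the maximum over states s of the least t with f^t(s) periodic
IsDepth : FDDS → ℕ → Set
IsDepth A d =
  (∀ s → ∃[ t ] (t ≤ d × Periodic A (iter (f A) t s))) ×
  (∃[ s ] (∀ t → t < d → ¬ Periodic A (iter (f A) t s)))

record RootedGraph : Set₁ where
  field
    Vertex : Set
    root   : Vertex
    Arc    : Vertex → Vertex → Set
open RootedGraph public

record _≅ᵗ_ (T U : RootedGraph) : Set where
  field
    bij      : Vertex T ↔ Vertex U
    root-pres : Inverse.to bij (root T) ≡ root U
    arc-pres  : ∀ x y → Arc T x y ⇔ Arc U (Inverse.to bij x) (Inverse.to bij y)

UVertex : (A : FDDS) → PeriodicState A → Set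
UVertex A u = Σ (State A × ℕ) λ p → iter (f A) (proj₂ p) (proj₁ p) ≡ state u

UArc : (A : FDDS) (u : PeriodicState A) → UVertex A u → UVertex A u → Set
UArc A u ((v , k) , _) ((w , j) , _) = (k ≡ suc j) × (w ≡ f A v)

udepth : {A : FDDS} {u : PeriodicState A} → UVertex A u → ℕ
udepth ((_ , k) , _) = k

unrollTree : (A : FDDS) → PeriodicState A → RootedGraph
unrollTree A u = record
  { Vertex = UVertex A u
  ; root   = (state u , 0) , refl
  ; Arc    = UArc A u
  }

truncUnrollTree : ℕ → (A : FDDS) → PeriodicState A → RootedGraph
truncUnrollTree n A u = record
  { Vertex = Σ (UVertex A u) λ x → udepth {A} {u} x ≤ n
  ; root   = ((state u , 0) , refl) , z≤n
  ; Arc    = λ x y → UArc A u (proj₁ x) (proj₁ y)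
  }

-- equality (isomorphism) of multisets of rooted trees, given as families
record MultisetIso {I J : Set} (T : I → RootedGraph) (U : J → RootedGraph) : Set where
  field
    σ   : I ↔ J
    iso : ∀ i → T i ≅ᵗ U (Inverse.to σ i)

UnrollEq : FDDS → FDDS → Set
UnrollEq A B = MultisetIso (unrollTree A) (unrollTree B)

TruncUnrollEq : ℕ → FDDS → FDDS → Set
TruncUnrollEq n A B = MultisetIso (truncUnrollTree n A) (truncUnrollTree n B)

module Submission where

-- An isomorphism of unroll trees amounts to bijections between the sets {s | f^k s = u} and
-- {t | g^k t = v}, for all k at once, commuting with f and g. Above a periodic state u runs the
-- spine u = a₀ ← a₁ ← a₂ ← … of its predecessors on the cycle, periodic with period at most α,
-- and the unroll tree is this spine with a forest Hⱼ hanging at each aⱼ; isomorphisms of all the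
-- Hⱼ glue to one of the unroll trees. As g^d sends every state of B to a periodic one, a
-- truncated isomorphism at depth n maps the spine of A onto that of B down to level n - d, and so
-- restricts to isomorphisms of the Hⱼ with j + 1 + d ≤ n: the hanging forests of B there have
-- height below d, and those of A can be no taller. Both sequences (Hⱼ) are periodic, with periods
-- p, q ≤ α, and two such sequences that agree for j < p + q agree everywhere; n ≥ 2α + d provides
-- exactly this.

open import Defs
open import Data.Fin using (Fin; toℕ; fromℕ<) renaming (_≟_ to _≟ᶠ_)
open import Data.Fin.Properties
  using (toℕ-injective; toℕ<n; toℕ-fromℕ<; injective⇒≤; pigeonhole; any?)
open import Data.Nat
  using (ℕ; zero; suc; _+_; _*_; _∸_; _≤_; _<_; z≤n; s≤s; s≤s⁻¹; z<s; _≤?_; _<?_)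
open import Data.Nat.Properties
open import Data.Nat.Induction using (<-rec)
open import Algebra.Properties.CommutativeSemigroup +-commutativeSemigroup using (x∙yz≈y∙xz)
open import Data.Product using (Σ; ∃; ∃-syntax; _×_; _,_; proj₁; proj₂)
open import Data.Product.Properties using (×-≡,≡→≡)
open import Function.Bundles using (_↔_; _⇔_; Inverse; Injection; Equivalence; mk↔ₛ′; mk⇔)
open import Function.Properties.Inverse using (↔-sym; ↔-trans; Inverse⇒Injection)
open import Function.Construct.Composition using (_⇔-∘_)
open import Function.Construct.Identity using (⇔-id)
open import Function.Construct.Symmetry using (⇔-sym)
open import Axiom.UniquenessOfIdentityProofs using (module Decidable⇒UIP)
open import Relation.Binary.Definitions using (tri<; tri≈; tri>)
open import Relation.Binary.Structures using (IsPartialEquivalence)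
open import Relation.Binary.PropositionalEquality
open import Relation.Nullary using (¬_; Dec; yes; no; contradiction)
open import Relation.Nullary.Decidable using (recompute; map′; _×-dec_; ¬?)

minimal : {P : ℕ → Set} → (∀ k → Dec (P k)) → ∀ {n} → P n →
          ∃[ k ] (P k × (∀ {j} → j < k → ¬ P j))
minimal P? {n} pn with P? 0
minimal P? {n}     pn | yes p₀ = 0 , p₀ , λ ()
minimal P? {zero}  p₀ | no ¬p₀ = contradiction p₀ ¬p₀
minimal P? {suc n} pn | no ¬p₀ with minimal (λ k → P? (suc k)) pn
... | k , pk , below = suc k , pk , λ { {zero} _ → ¬p₀ ; {suc j} (s≤s j<k) → below j<k }

-- A weak form of the Fine–Wilf periodicity lemma.
module _ {X : Set} {_~_ : X → X → Set} (~-isPEq : IsPartialEquivalence _~_)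
         (a b : ℕ → X) (p q : ℕ)
         (a-periodic : ∀ j → a j ~ a (suc p + j)) (b-periodic : ∀ j → b j ~ b (suc q + j))
         (agree : ∀ j → j < suc p + suc q → a j ~ b j) where

  open IsPartialEquivalence ~-isPEq renaming (sym to ~-sym; trans to ~-trans)

  private
    a-shift : ∀ j → a j ~ a (suc q + j)
    a-shift = <-rec _ step
      where
      step : ∀ j → (∀ {i} → i < j → a i ~ a (suc q + i)) → a j ~ a (suc q + j)
      step j ih with j <? suc p
      ... | yes j<p = ~-trans (agree j (≤-trans j<p (m≤m+n (suc p) (suc q))))
                            (~-trans (b-periodic j) (~-sym (agree (suc q + j) q+j<p+q)))
        where
        q+j<p+q : suc q + j < suc p + suc q
        q+j<p+q = subst (suc q + j <_) (+-comm (suc q) (suc p)) (+-monoʳ-< (suc q) j<p)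
      ... | no j≮p with m≤n⇒∃[o]m+o≡n (≮⇒≥ j≮p)
      ...   | r , refl = ~-trans (~-sym (a-periodic r))
                           (~-trans (ih (m<n+m r z<s))
                             (subst (λ i → a (suc q + r) ~ a i) (x∙yz≈y∙xz (suc p) (suc q) r)
                               (a-periodic (suc q + r))))

  periodic-agreement : ∀ j → a j ~ b j
  periodic-agreement = <-rec _ step
    where
    step : ∀ j → (∀ {i} → i < j → a i ~ b i) → a j ~ b j
    step j ih with j <? suc q
    ... | yes j<q = agree j (≤-trans j<q (m≤n+m (suc q) (suc p)))
    ... | no j≮q with m≤n⇒∃[o]m+o≡n (≮⇒≥ j≮q)
    ...   | r , refl = ~-trans (~-sym (a-shift r)) (~-trans (ih (m<n+m r z<s)) (b-periodic r))

-- Iterates and periodic states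

module _ {X : Set} (g : X → X) where

  iter-+ : ∀ m n x → iter g (m + n) x ≡ iter g m (iter g n x)
  iter-+ zero    n x = refl
  iter-+ (suc m) n x = cong g (iter-+ m n x)

  iter-suc : ∀ m x → iter g (suc m) x ≡ iter g m (g x)
  iter-suc zero    x = refl
  iter-suc (suc m) x = cong g (iter-suc m x)

  iter-*-fixed : ∀ p {x} → iter g p x ≡ x → ∀ r → iter g (r * p) x ≡ x
  iter-*-fixed p     fixed zero    = refl
  iter-*-fixed p {x} fixed (suc r) =
    trans (iter-+ p (r * p) x) (trans (cong (iter g p) (iter-*-fixed p fixed r)) fixed)

  iter-backward : (a : ℕ → X) → (∀ j → g (a (suc j)) ≡ a j) → ∀ m k → iter g m (a (m + k)) ≡ a k
  iter-backward a step zero    k = refl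
  iter-backward a step (suc m) k =
    trans (iter-suc m _) (trans (cong (iter g m) (step (m + k))) (iter-backward a step m k))

  iter-cancel : ∀ {c k x y} → k ≤ c → iter g c x ≡ x → iter g c y ≡ y →
                iter g k x ≡ iter g k y → x ≡ y
  iter-cancel {c} {k} {x} {y} k≤c x-fixed y-fixed eq = begin
    x                     ≡⟨ sym x-fixed ⟩
    iter g c x            ≡⟨ cong (λ m → iter g m x) c≡r+k ⟩
    iter g (r + k) x      ≡⟨ iter-+ r k x ⟩
    iter g r (iter g k x) ≡⟨ cong (iter g r) eq ⟩
    iter g r (iter g k y) ≡⟨ iter-+ r k y ⟨
    iter g (r + k) y      ≡⟨ cong (λ m → iter g m y) c≡r+k ⟨
    iter g c y            ≡⟨ y-fixed ⟩
    y                     ∎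
    where
    open ≡-Reasoning
    r = proj₁ (m≤n⇒∃[o]m+o≡n k≤c)
    c≡r+k : c ≡ r + k
    c≡r+k = trans (sym (proj₂ (m≤n⇒∃[o]m+o≡n k≤c))) (+-comm k r)

module _ (S : FDDS) where

  Periodic-iter : ∀ m {x} → Periodic S x → Periodic S (iter (f S) m x)
  Periodic-iter m {x} (p , cycle) =
    p , trans (sym (iter-+ (f S) (suc p) m x))
              (trans (cong (λ k → iter (f S) k x) (+-comm (suc p) m))
                     (trans (iter-+ (f S) m (suc p) x) (cong (iter (f S) m) cycle)))

  periodic-injective : ∀ {x y} → Periodic S x → Periodic S y →
                       ∀ k → iter (f S) k x ≡ iter (f S) k y → x ≡ y
  periodic-injective {x} {y} (p , x-cycle) (q , y-cycle) k =
    iter-cancel (f S) k≤c (iter-*-fixed (f S) N x-fixed (suc k)) (iter-*-fixed (f S) N y-fixed (suc k))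
    where
    N = suc q * suc p
    x-fixed : iter (f S) N x ≡ x
    x-fixed = iter-*-fixed (f S) (suc p) x-cycle (suc q)
    y-fixed : iter (f S) N y ≡ y
    y-fixed = subst (λ m → iter (f S) m y ≡ y) (*-comm (suc p) (suc q))
                    (iter-*-fixed (f S) (suc q) y-cycle (suc p))
    k≤c : k ≤ suc k * N
    k≤c = ≤-trans (n≤1+n k) (m≤m*n (suc k) N)

  Periodic-later : ∀ {t m} → t ≤ m → ∀ s → Periodic S (iter (f S) t s) → Periodic S (iter (f S) m s)
  Periodic-later {t} {m} t≤m s periodic = subst (Periodic S) (sym (begin
    iter (f S) m s                ≡⟨ cong (λ k → iter (f S) k s) m≡e+t ⟩
    iter (f S) (e + t) s          ≡⟨ iter-+ (f S) e t s ⟩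
    iter (f S) e (iter (f S) t s) ∎)) (Periodic-iter e periodic)
    where
    open ≡-Reasoning
    e = proj₁ (m≤n⇒∃[o]m+o≡n t≤m)
    m≡e+t : m ≡ e + t
    m≡e+t = trans (sym (proj₂ (m≤n⇒∃[o]m+o≡n t≤m))) (+-comm t e)

  period-bound : ∀ {x} → Periodic S x → ∃[ k ] (k < size S × iter (f S) (suc k) x ≡ x)
  period-bound {x} x-periodic
    with pigeonhole (n<1+n (size S)) (λ (i : Fin (suc (size S))) → iter (f S) (toℕ i) x)
  ... | i , j , i<j , orbit-eq =
    r , r<size , periodic-injective (Periodic-iter (suc r) x-periodic) x-periodic (toℕ i) (begin
    iter (f S) (toℕ i) (iter (f S) (suc r) x) ≡⟨ iter-+ (f S) (toℕ i) (suc r) x ⟨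
    iter (f S) (toℕ i + suc r) x              ≡⟨ cong (λ k → iter (f S) k x) i+r≡j ⟩
    iter (f S) (toℕ j) x                      ≡⟨ orbit-eq ⟨
    iter (f S) (toℕ i) x                      ∎)
    where
    open ≡-Reasoning
    r = proj₁ (m≤n⇒∃[o]m+o≡n i<j)
    i+r≡j : toℕ i + suc r ≡ toℕ j
    i+r≡j = trans (+-suc (toℕ i) r) (proj₂ (m≤n⇒∃[o]m+o≡n i<j))
    r<size : r < size S
    r<size = ≤-trans (m≤n+m (suc r) (toℕ i))
                     (s≤s⁻¹ (subst (_< suc (size S)) (sym i+r≡j) (toℕ<n j)))

  Periodic? : ∀ x → Dec (Periodic S x)
  Periodic? x =
    map′ (λ (i , cycle) → toℕ i , cycle) bounded (any? (λ i → iter (f S) (suc (toℕ i)) x ≟ᶠ x))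
    where
    bounded : Periodic S x → ∃ λ (i : Fin (size S)) → iter (f S) (suc (toℕ i)) x ≡ x
    bounded x-periodic with period-bound x-periodic
    ... | k , k<size , cycle =
      fromℕ< k<size , subst (λ m → iter (f S) (suc m) x ≡ x) (sym (toℕ-fromℕ< k<size)) cycle

  minimalPeriod : ∀ {x} → .(Periodic S x) →
                  ∃[ p ] (iter (f S) (suc p) x ≡ x × (∀ {j} → j < p → ¬ iter (f S) (suc j) x ≡ x))
  minimalPeriod {x} x-periodic with recompute (Periodic? x) x-periodic
  ... | p , cycle = minimal (λ k → iter (f S) (suc k) x ≟ᶠ x) {p} cycle

IsDepth⇒deep : ∀ {S d} → IsDepth S d → ∀ s → Periodic S (iter (f S) d s)
IsDepth⇒deep {S} (reach , _) s = Periodic-later S (proj₁ (proj₂ (reach s))) s (proj₂ (proj₂ (reach s)))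

module Spine (S : FDDS) {x : State S} (p : ℕ) (cycle : iter (f S) (suc p) x ≡ x) where

  -- f^(j p) x is the j-th predecessor of x on its cycle, which has length suc p.
  spine : ℕ → State S
  spine j = iter (f S) (j * p) x

  spine-step : ∀ j → f S (spine (suc j)) ≡ spine j
  spine-step j = begin
    iter (f S) (suc (p + j * p)) x            ≡⟨ cong (λ m → iter (f S) m x) (+-comm (suc p) (j * p)) ⟩
    iter (f S) (j * p + suc p) x              ≡⟨ iter-+ (f S) (j * p) (suc p) x ⟩
    iter (f S) (j * p) (iter (f S) (suc p) x) ≡⟨ cong (iter (f S) (j * p)) cycle ⟩
    spine j                                   ∎
    where open ≡-Reasoning

  spine-periodic : ∀ j → Periodic S (spine j)
  spine-periodic j = Periodic-iter S (j * p) (p , cycle)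

  spine-above : ∀ j → iter (f S) j (spine j) ≡ x
  spine-above j =
    subst (λ i → iter (f S) j (spine i) ≡ x) (+-identityʳ j) (iter-backward (f S) spine spine-step j 0)

  spine-unique : ∀ k {c} → Periodic S c → iter (f S) k c ≡ x → c ≡ spine k
  spine-unique k c-periodic above =
    periodic-injective S c-periodic (spine-periodic k) k (trans above (sym (spine-above k)))

  spine-cyclic : ∀ j → spine (suc p + j) ≡ spine j
  spine-cyclic j = sym (spine-unique (suc p + j) (spine-periodic j) (begin
    iter (f S) (suc p + j) (spine j)            ≡⟨ iter-+ (f S) (suc p) j (spine j) ⟩
    iter (f S) (suc p) (iter (f S) j (spine j)) ≡⟨ cong (iter (f S) (suc p)) (spine-above j) ⟩
    iter (f S) (suc p) x                        ≡⟨ cycle ⟩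
    x                                           ∎))
    where open ≡-Reasoning

  module _ (p-minimal : ∀ {j} → j < p → ¬ iter (f S) (suc j) x ≡ x) where

    spine-distinct : ∀ {i j} → i < j → j ≤ p → spine i ≢ spine j
    spine-distinct {i} {j} i<j j≤p eq = p-minimal r<p (begin
      iter (f S) (suc r) x                        ≡⟨ cong (iter (f S) (suc r)) (spine-above i) ⟨
      iter (f S) (suc r) (iter (f S) i (spine i)) ≡⟨ iter-+ (f S) (suc r) i (spine i) ⟨
      iter (f S) (suc r + i) (spine i)            ≡⟨ cong (λ m → iter (f S) m (spine i)) j≡ ⟩
      iter (f S) j (spine i)                      ≡⟨ cong (iter (f S) j) eq ⟩
      iter (f S) j (spine j)                      ≡⟨ spine-above j ⟩
      x                                           ∎)
      where
      open ≡-Reasoning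
      r = proj₁ (m≤n⇒∃[o]m+o≡n i<j)
      j≡ : suc r + i ≡ j
      j≡ = trans (cong suc (+-comm r i)) (proj₂ (m≤n⇒∃[o]m+o≡n i<j))
      r<p : r < p
      r<p = ≤-trans (s≤s (m≤m+n r i)) (subst (_≤ p) (sym j≡) j≤p)

    spine-injective : ∀ {i j} → i ≤ p → j ≤ p → spine i ≡ spine j → i ≡ j
    spine-injective {i} {j} i≤p j≤p eq with <-cmp i j
    ... | tri< i<j _ _ = contradiction eq (spine-distinct i<j j≤p)
    ... | tri≈ _ i≡j _ = i≡j
    ... | tri> _ _ j<i = contradiction (sym eq) (spine-distinct j<i i≤p)

    period≤ : ∀ {α} → PeriodicState S ↔ Fin α → suc p ≤ α
    period≤ E = injective⇒≤ {f = index} index-injective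
      where
      index : Fin (suc p) → Fin _
      index i = Inverse.to E (pstate (spine (toℕ i)) (spine-periodic (toℕ i)))
      index-injective : ∀ {i j} → index i ≡ index j → i ≡ j
      index-injective {i} {j} eq = toℕ-injective
        (spine-injective (≤-pred (toℕ<n i)) (≤-pred (toℕ<n j))
          (cong state (Injection.injective (Inverse⇒Injection E) eq)))

-- Level isomorphisms

Levels : Set → Set₁
Levels X = ℕ → X → Set

cong-irr : {X B : Set} {P : Levels X} (F : ∀ k s → .(P k s) → B) {k k′ : ℕ} {s s′ : X} →
           k ≡ k′ → s ≡ s′ → .(p : P k s) .(p′ : P k′ s′) → F k s p ≡ F k′ s′ p′
cong-irr F refl refl _ _ = refl

StepClosed : {X : Set} → (X → X) → Levels X → Set
StepClosed {X} F P = ∀ {k} {s : X} → P (suc k) s → P k (F s)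

truncate : {X : Set} → ℕ → Levels X → Levels X
truncate n P k s = k ≤ n × P k s

-- An isomorphism of the forests whose depth-k vertices are the s with P k s (resp. Q k s),
-- with arcs s → F s (resp. t → G t).
record LevelIso {X Y : Set} (F : X → X) (G : Y → Y) (P : Levels X) (Q : Levels Y) : Set where
  field
    to           : ∀ k s → .(P k s) → Y
    from         : ∀ k t → .(Q k t) → X
    to-level     : ∀ k s .(p : P k s) → Q k (to k s p)
    from-level   : ∀ k t .(q : Q k t) → P k (from k t q)
    from-to      : ∀ k s .(p : P k s) → from k (to k s p) (to-level k s p) ≡ s
    to-from      : ∀ k t .(q : Q k t) → to k (from k t q) (from-level k t q) ≡ t
    to-commute   : ∀ k s .(p : P (suc k) s) .(p′ : P k (F s)) → G (to (suc k) s p) ≡ to k (F s) p′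
    from-commute : ∀ k t .(q : Q (suc k) t) .(q′ : Q k (G t)) → F (from (suc k) t q) ≡ from k (G t) q′

  to-injective : ∀ k {s s′} .(p : P k s) .(p′ : P k s′) → to k s p ≡ to k s′ p′ → s ≡ s′
  to-injective k {s} {s′} p p′ eq =
    trans (sym (from-to k s p)) (trans (cong-irr from refl eq _ _) (from-to k s′ p′))

  to-iter-commute : StepClosed F P → ∀ m k s .(p : P (m + k) s) .(p′ : P k (iter F m s)) →
                    iter G m (to (m + k) s p) ≡ to k (iter F m s) p′
  to-iter-commute closed zero    k s p p′ = refl
  to-iter-commute closed (suc m) k s p p′ = begin
    iter G (suc m) (to (suc m + k) s p)    ≡⟨ iter-suc G m _ ⟩
    iter G m (G (to (suc m + k) s p))      ≡⟨ cong (iter G m) (to-commute (m + k) s p (closed p)) ⟩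
    iter G m (to (m + k) (F s) (closed p)) ≡⟨ to-iter-commute closed m k (F s) (closed p)
                                                (subst (P k) (iter-suc F m s) p′) ⟩
    to k (iter F m (F s)) _                ≡⟨ cong-irr to refl (iter-suc F m s) _ _ ⟨
    to k (iter F (suc m) s) p′             ∎
    where open ≡-Reasoning

open LevelIso public

module _ {X Y : Set} {F : X → X} {G : Y → Y} {P : Levels X} {Q : Levels Y} where

  LevelIso-sym : LevelIso F G P Q → LevelIso G F Q P
  LevelIso-sym I = record
    { to = from I ; from = to I ; to-level = from-level I ; from-level = to-level I
    ; from-to = to-from I ; to-from = from-to I
    ; to-commute = from-commute I ; from-commute = to-commute I }

  LevelIso-truncate : ∀ n → LevelIso F G P Q → LevelIso F G (truncate n P) (truncate n Q)
  LevelIso-truncate n I = record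
    { to = λ k s p → to I k s (proj₂ p)
    ; from = λ k t q → from I k t (proj₂ q)
    ; to-level = λ k s p → recompute (k ≤? n) (proj₁ p) , to-level I k s (proj₂ p)
    ; from-level = λ k t q → recompute (k ≤? n) (proj₁ q) , from-level I k t (proj₂ q)
    ; from-to = λ k s p → from-to I k s (proj₂ p)
    ; to-from = λ k t q → to-from I k t (proj₂ q)
    ; to-commute = λ k s p p′ → to-commute I k s (proj₂ p) (proj₂ p′)
    ; from-commute = λ k t q q′ → from-commute I k t (proj₂ q) (proj₂ q′) }

LevelIso-refl : {X : Set} {F : X → X} {P : Levels X} → (∀ k s → Dec (P k s)) → LevelIso F F P P
LevelIso-refl P? = record
  { to = λ _ s _ → s ; from = λ _ s _ → s
  ; to-level = λ k s p → recompute (P? k s) p ; from-level = λ k s p → recompute (P? k s) p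
  ; from-to = λ _ _ _ → refl ; to-from = λ _ _ _ → refl
  ; to-commute = λ _ _ _ _ → refl ; from-commute = λ _ _ _ _ → refl }

LevelIso-trans : {X Y Z : Set} {F : X → X} {G : Y → Y} {H : Z → Z}
                 {P : Levels X} {Q : Levels Y} {R : Levels Z} →
                 LevelIso F G P Q → LevelIso G H Q R → LevelIso F H P R
LevelIso-trans {Q = Q} I J = record
  { to = λ k s p → to J k (to I k s p) (to-level I k s p)
  ; from = λ k z r → from I k (from J k z r) (from-level J k z r)
  ; to-level = λ k s p → to-level J k _ (to-level I k s p)
  ; from-level = λ k z r → from-level I k _ (from-level J k z r)
  ; from-to = λ k s p →
      trans (cong-irr (from I) refl (from-to J k _ (to-level I k s p)) _ _) (from-to I k s p)
  ; to-from = λ k z r →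
      trans (cong-irr (to J) refl (to-from I k _ (from-level J k z r)) _ _) (to-from J k z r)
  ; to-commute = λ k s p p′ →
      trans (to-commute J k _ (to-level I (suc k) s p)
                        (subst (Q k) (sym (to-commute I k s p p′)) (to-level I k _ p′)))
            (cong-irr (to J) refl (to-commute I k s p p′) _ _)
  ; from-commute = λ k z r r′ →
      trans (from-commute I k _ (from-level J (suc k) z r)
                          (subst (Q k) (sym (from-commute J k z r r′)) (from-level J k _ r′)))
            (cong-irr (from I) refl (from-commute J k z r r′) _ _)
  }

-- Graded trees

≅ᵗ-sym : {T U : RootedGraph} → T ≅ᵗ U → U ≅ᵗ T
≅ᵗ-sym {T} {U} i = record
  { bij = ↔-sym bij
  ; root-pres = trans (cong ψ (sym root-pres)) (Inverse.strictlyInverseʳ bij (root T))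
  ; arc-pres = λ x y → ⇔-sym (subst₂ (λ x′ y′ → Arc T (ψ x) (ψ y) ⇔ Arc U x′ y′)
                                      (Inverse.strictlyInverseˡ bij x) (Inverse.strictlyInverseˡ bij y)
                                      (arc-pres (ψ x) (ψ y)))
  }
  where
  open _≅ᵗ_ i
  ψ = Inverse.from bij

≅ᵗ-trans : {T U W : RootedGraph} → T ≅ᵗ U → U ≅ᵗ W → T ≅ᵗ W
≅ᵗ-trans i j = record
  { bij = ↔-trans (bij i) (bij j)
  ; root-pres = trans (cong (Inverse.to (bij j)) (root-pres i)) (root-pres j)
  ; arc-pres = λ x y → arc-pres j _ _ ⇔-∘ arc-pres i x y
  }
  where open _≅ᵗ_

record TreeLevels (S : FDDS) (x : State S) : Set₁ where
  field
    Level            : Levels (State S)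
    level?           : ∀ k s → Dec (Level k s)
    level-irrelevant : ∀ {k s} (p q : Level k s) → p ≡ q
    root-level       : Level 0 x
    level-zero       : ∀ {s} → Level 0 s → s ≡ x
    level-closed     : StepClosed (f S) Level
open TreeLevels public

module _ {S : FDDS} {x : State S} (L : TreeLevels S x) where

  gradedTree : RootedGraph
  gradedTree = record
    { Vertex = Σ (State S × ℕ) λ v → Level L (proj₂ v) (proj₁ v)
    ; root   = (x , 0) , root-level L
    ; Arc    = λ v w → (proj₂ (proj₁ v) ≡ suc (proj₂ (proj₁ w)))
                     × (proj₁ (proj₁ w) ≡ f S (proj₁ (proj₁ v)))
    }

  vertex : ∀ k s → Level L k s → Vertex gradedTree
  vertex k s p = (s , k) , p

  label : Vertex gradedTree → State S
  label v = proj₁ (proj₁ v)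

  depth : Vertex gradedTree → ℕ
  depth v = proj₂ (proj₁ v)

  vertex-≡ : ∀ {v w} → label v ≡ label w → depth v ≡ depth w → v ≡ w
  vertex-≡ {(s , k) , p} {(.s , .k) , q} refl refl = cong (vertex k s) (level-irrelevant L p q)

truncated : {S : FDDS} {x : State S} → ℕ → TreeLevels S x → TreeLevels S x
truncated n L = record
  { Level            = truncate n (Level L)
  ; level?           = λ k s → (k ≤? n) ×-dec level? L k s
  ; level-irrelevant = λ p q →
      ×-≡,≡→≡ (≤-irrelevant (proj₁ p) (proj₁ q) , level-irrelevant L (proj₂ p) (proj₂ q))
  ; root-level       = z≤n , root-level L
  ; level-zero       = λ p → level-zero L (proj₂ p)
  ; level-closed     = λ p → ≤-trans (n≤1+n _) (proj₁ p) , level-closed L (proj₂ p)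
  }

Above : (S : FDDS) → State S → Levels (State S)
Above S x k s = iter (f S) k s ≡ x

Above≤ : ℕ → (S : FDDS) → State S → Levels (State S)
Above≤ n S x = truncate n (Above S x)

above : (S : FDDS) (x : State S) → TreeLevels S x
above S x = record
  { Level            = Above S x
  ; level?           = λ k s → iter (f S) k s ≟ᶠ x
  ; level-irrelevant = Decidable⇒UIP.≡-irrelevant _≟ᶠ_
  ; root-level       = refl
  ; level-zero       = λ p → p
  ; level-closed     = λ {k} {s} p → trans (sym (iter-suc (f S) k s)) p
  }

-- unrollTree S u is gradedTree (above S (state u)) on the nose; the truncated unroll tree
-- nests its vertices differently.
truncUnrollTree≅graded : ∀ n (S : FDDS) (u : PeriodicState S) →
                         truncUnrollTree n S u ≅ᵗ gradedTree (truncated n (above S (state u)))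
truncUnrollTree≅graded n S u = record
  { bij       = mk↔ₛ′ (λ ((v , e) , le) → v , le , e) (λ (v , le , e) → (v , e) , le)
                      (λ _ → refl) (λ _ → refl)
  ; root-pres = refl
  ; arc-pres  = λ _ _ → ⇔-id _
  }

module TreeIsoTransport {S T : FDDS} {x : State S} {y : State T} (L : TreeLevels S x) (M : TreeLevels T y)
                        (i : gradedTree L ≅ᵗ gradedTree M) where
  open _≅ᵗ_ i
  φ = Inverse.to bij

  depth-φ : ∀ k s (p : Level L k s) → depth M (φ (vertex L k s p)) ≡ k
  depth-φ zero    s p = cong (depth M) (trans (cong φ (vertex-≡ L (level-zero L p) refl)) root-pres)
  depth-φ (suc k) s p =
    trans (proj₁ (Equivalence.to (arc-pres (vertex L (suc k) s p) (vertex L k (f S s) p′)) (refl , refl)))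
          (cong suc (depth-φ k (f S s) p′))
    where p′ = level-closed L p

  transport : ∀ k s → .(Level L k s) → State T
  transport k s p = label M (φ (vertex L k s (recompute (level? L k s) p)))

  transport-level : ∀ k s .(p : Level L k s) → Level M k (transport k s p)
  transport-level k s p = subst (λ j → Level M j (label M w)) (depth-φ k s _) (proj₂ w)
    where w = φ (vertex L k s (recompute (level? L k s) p))

  φ-vertex : ∀ k s .(p : Level L k s) (q : Level M k (transport k s p)) →
             φ (vertex L k s (recompute (level? L k s) p)) ≡ vertex M k (transport k s p) q
  φ-vertex k s p q = vertex-≡ M refl (depth-φ k s _)

  transport-commute : ∀ k s .(p : Level L (suc k) s) .(p′ : Level L k (f S s)) →
                      f T (transport (suc k) s p) ≡ transport k (f S s) p′
  transport-commute k s p p′ =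
    sym (proj₂ (Equivalence.to (arc-pres (vertex L (suc k) s _) (vertex L k (f S s) _)) (refl , refl)))

module _ {S T : FDDS} {x : State S} {y : State T} (L : TreeLevels S x) (M : TreeLevels T y) where

  treeIso⇒levelIso : gradedTree L ≅ᵗ gradedTree M → LevelIso (f S) (f T) (Level L) (Level M)
  treeIso⇒levelIso i = record
    { to = F.transport ; from = B.transport
    ; to-level = F.transport-level ; from-level = B.transport-level
    ; from-to = λ k s p →
        cong (label L) (trans (cong (Inverse.from bij) (sym (F.φ-vertex k s p _))) (Inverse.strictlyInverseʳ bij _))
    ; to-from = λ k t q →
        cong (label M) (trans (cong (Inverse.to bij) (sym (B.φ-vertex k t q _))) (Inverse.strictlyInverseˡ bij _))
    ; to-commute = F.transport-commute ; from-commute = B.transport-commute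
    }
    where
    open _≅ᵗ_ i
    module F = TreeIsoTransport L M i
    module B = TreeIsoTransport M L (≅ᵗ-sym i)

  levelIso⇒treeIso : LevelIso (f S) (f T) (Level L) (Level M) → gradedTree L ≅ᵗ gradedTree M
  levelIso⇒treeIso I = record
    { bij       = mk↔ₛ′ φ ψ (λ w → vertex-≡ M (to-from I _ _ (proj₂ w)) refl)
                            (λ v → vertex-≡ L (from-to I _ _ (proj₂ v)) refl)
    ; root-pres = vertex-≡ M (level-zero M (to-level I 0 x (root-level L))) refl
    ; arc-pres  = λ v w → mk⇔ (forward v w) (backward v w)
    }
    where
    φ : Vertex (gradedTree L) → Vertex (gradedTree M)
    φ ((s , k) , p) = vertex M k (to I k s p) (to-level I k s p)
    ψ : Vertex (gradedTree M) → Vertex (gradedTree L)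
    ψ ((t , k) , q) = vertex L k (from I k t q) (from-level I k t q)

    forward : ∀ v w → Arc (gradedTree L) v w → Arc (gradedTree M) (φ v) (φ w)
    forward ((s , .(suc k)) , p) ((.(f S s) , k) , p′) (refl , refl) = refl , sym (to-commute I k s p p′)

    backward : ∀ v w → Arc (gradedTree M) (φ v) (φ w) → Arc (gradedTree L) v w
    backward ((s , .(suc k)) , p) ((t , k) , p′) (refl , e) =
      refl , to-injective I k p′ (level-closed L p) (trans e (to-commute I k s p _))

module _ (n : ℕ) {A B : FDDS} (u : PeriodicState A) (v : PeriodicState B) where

  private
    Lᴬ = truncated n (above A (state u))
    Lᴮ = truncated n (above B (state v))

  unrollIso⇒truncIso : unrollTree A u ≅ᵗ unrollTree B v →
                       truncUnrollTree n A u ≅ᵗ truncUnrollTree n B v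
  unrollIso⇒truncIso i =
    ≅ᵗ-trans (truncUnrollTree≅graded n A u)
      (≅ᵗ-trans (levelIso⇒treeIso Lᴬ Lᴮ
                  (LevelIso-truncate n (treeIso⇒levelIso (above A (state u)) (above B (state v)) i)))
                (≅ᵗ-sym (truncUnrollTree≅graded n B v)))

  truncIso⇒levelIso : truncUnrollTree n A u ≅ᵗ truncUnrollTree n B v →
                      LevelIso (f A) (f B) (Above≤ n A (state u)) (Above≤ n B (state v))
  truncIso⇒levelIso i = treeIso⇒levelIso Lᴬ Lᴮ
    (≅ᵗ-trans (≅ᵗ-sym (truncUnrollTree≅graded n A u)) (≅ᵗ-trans i (truncUnrollTree≅graded n B v)))

-- Hanging forests

-- The forest hanging at x off the spine, when f y = x: the states reaching x without passing
-- through y, a state at distance t + 1 from x being put at level t.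
Hanging : (S : FDDS) → State S → State S → Levels (State S)
Hanging S x y t s = Above S x (suc t) s × ¬ Above S y t s

Hanging? : (S : FDDS) (x y : State S) → ∀ t s → Dec (Hanging S x y t s)
Hanging? S x y t s = (iter (f S) (suc t) s ≟ᶠ x) ×-dec ¬? (iter (f S) t s ≟ᶠ y)

Hanging-ancestor : ∀ {S : FDDS} {x y} j t s → Hanging S x y t s →
                   iter (f S) (suc j) (iter (f S) t s) ≡ iter (f S) j x
Hanging-ancestor {S} j t s h = trans (iter-suc (f S) j _) (cong (iter (f S) j) (proj₁ h))

HangingSite : Set
HangingSite = Σ FDDS λ S → State S × State S

_≃ʰ_ : HangingSite → HangingSite → Set
(S , x , y) ≃ʰ (T , x′ , y′) = LevelIso (f S) (f T) (Hanging S x y) (Hanging T x′ y′)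

≃ʰ-isPartialEquivalence : IsPartialEquivalence _≃ʰ_
≃ʰ-isPartialEquivalence = record { sym = LevelIso-sym ; trans = LevelIso-trans }

-- The tree above a j is the forest hanging at a j together with the tree above a (suc j),
-- lowered by one level: glue follows the spine until s leaves it.
module Glue {S T : FDDS} (a : ℕ → State S) (b : ℕ → State T) (b-step : ∀ j → f T (b (suc j)) ≡ b j)
            (H : ∀ j → (S , a j , a (suc j)) ≃ʰ (T , b j , b (suc j))) where

  glue : ∀ j k s → .(Above S (a j) k s) → State T
  glue j zero    s p = b j
  glue j (suc k) s p with iter (f S) k s ≟ᶠ a (suc j)
  ... | yes e = glue (suc j) k s e
  ... | no ne = to (H j) k s (p , ne)

  glue-level : ∀ j k s .(p : Above S (a j) k s) → Above T (b j) k (glue j k s p)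
  glue-level j zero    s p = refl
  glue-level j (suc k) s p with iter (f S) k s ≟ᶠ a (suc j)
  ... | yes e = trans (cong (f T) (glue-level (suc j) k s e)) (b-step j)
  ... | no ne = proj₁ (to-level (H j) k s (p , ne))

  glue-commute : ∀ j k s .(p : Above S (a j) (suc k) s) .(p′ : Above S (a j) k (f S s)) →
                 f T (glue j (suc k) s p) ≡ glue j k (f S s) p′
  glue-commute j zero s p p′ with s ≟ᶠ a (suc j)
  ... | yes _ = b-step j
  ... | no ne = proj₁ (to-level (H j) 0 s (p , ne))
  glue-commute j (suc k) s p p′
    with iter (f S) (suc k) s ≟ᶠ a (suc j) | iter (f S) k (f S s) ≟ᶠ a (suc j)
  ... | yes e | yes e′ = glue-commute (suc j) k s e e′
  ... | yes e | no ne′ = contradiction (trans (sym (iter-suc (f S) k s)) e) ne′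
  ... | no ne | yes e′ = contradiction (trans (iter-suc (f S) k s) e′) ne
  ... | no ne | no ne′ = to-commute (H j) k s (p , ne) (p′ , ne′)

module _ {S T : FDDS} (a : ℕ → State S) (b : ℕ → State T)
         (a-step : ∀ j → f S (a (suc j)) ≡ a j) (b-step : ∀ j → f T (b (suc j)) ≡ b j)
         (H : ∀ j → (S , a j , a (suc j)) ≃ʰ (T , b j , b (suc j))) where

  private
    module G = Glue a b b-step H
    module G′ = Glue b a a-step (λ j → LevelIso-sym (H j))

  glue-inverse : ∀ j k s .(p : Above S (a j) k s) →
                 G′.glue j k (G.glue j k s p) (G.glue-level j k s p) ≡ s
  glue-inverse j zero s p = sym (recompute (s ≟ᶠ a j) p)
  glue-inverse j (suc k) s p with iter (f S) k s ≟ᶠ a (suc j)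
  ... | yes e with iter (f T) k (G.glue (suc j) k s e) ≟ᶠ b (suc j)
  ...   | yes _  = glue-inverse (suc j) k s e
  ...   | no ne′ = contradiction (G.glue-level (suc j) k s e) ne′
  glue-inverse j (suc k) s p | no ne with iter (f T) k (to (H j) k s (p , ne)) ≟ᶠ b (suc j)
  ...   | yes e′ = contradiction e′ (proj₂ (to-level (H j) k s (p , ne)))
  ...   | no _   = from-to (H j) k s (p , ne)

LevelIso-glue : {S T : FDDS} (a : ℕ → State S) (b : ℕ → State T) →
                (∀ j → f S (a (suc j)) ≡ a j) → (∀ j → f T (b (suc j)) ≡ b j) →
                (∀ j → (S , a j , a (suc j)) ≃ʰ (T , b j , b (suc j))) →
                ∀ j → LevelIso (f S) (f T) (Above S (a j)) (Above T (b j))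
LevelIso-glue a b a-step b-step H j = record
  { to = G.glue j ; from = G′.glue j
  ; to-level = G.glue-level j ; from-level = G′.glue-level j
  ; from-to = glue-inverse a b a-step b-step H j
  ; to-from = glue-inverse b a b-step a-step H′ j
  ; to-commute = G.glue-commute j ; from-commute = G′.glue-commute j
  }
  where
  H′ = λ j → LevelIso-sym (H j)
  module G = Glue a b b-step H
  module G′ = Glue b a a-step H′

module _ (S : FDDS) {x : State S} (p : ℕ) (cycle : iter (f S) (suc p) x ≡ x) where
  open Spine S p cycle

  spineSite : ℕ → HangingSite
  spineSite j = S , spine j , spine (suc j)

  spineSite-periodic : ∀ j → spineSite j ≃ʰ spineSite (suc p + j)
  spineSite-periodic j =
    subst₂ (λ y z → LevelIso (f S) (f S) (Hanging S (spine j) (spine (suc j))) (Hanging S y z))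
           (sym (spine-cyclic j))
           (trans (sym (spine-cyclic (suc j))) (cong spine (+-suc (suc p) j)))
           (LevelIso-refl (Hanging? S _ _))

-- Truncated isomorphisms

module HangingTransport (n : ℕ) {S T : FDDS} {x : State S} {y : State T}
                        (ψ : LevelIso (f S) (f T) (Above≤ n S x) (Above≤ n T y))
                        (a : ℕ → State S) (b : ℕ → State T) (a-above : ∀ k → Above S x k (a k))
                        (j : ℕ) (j<n : j < n)
                        (ψ-spine : ∀ k → k ≤ suc j → .(p : Above≤ n S x k (a k)) →
                                   to ψ k (a k) p ≡ b k)
                        (bound : ∀ t s → Hanging S (a j) (a (suc j)) t s → suc t + j ≤ n) where

  private
    ψ-closed = level-closed (truncated n (above S x))

    hanging-level : ∀ t s → Hanging S (a j) (a (suc j)) t s → Above≤ n S x (suc t + j) s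
    hanging-level t s h = bound t s h , (begin
      iter (f S) (suc t + j) s              ≡⟨ cong (λ m → iter (f S) m s) (+-comm (suc t) j) ⟩
      iter (f S) (j + suc t) s              ≡⟨ iter-+ (f S) j (suc t) s ⟩
      iter (f S) j (iter (f S) (suc t) s)   ≡⟨ cong (iter (f S) j) (proj₁ h) ⟩
      iter (f S) j (a j)                    ≡⟨ a-above j ⟩
      x                                     ∎)
      where open ≡-Reasoning

    ancestor-level : ∀ t s → Hanging S (a j) (a (suc j)) t s → Above≤ n S x (suc j) (iter (f S) t s)
    ancestor-level t s h = j<n , trans (Hanging-ancestor j t s h) (a-above j)

    spine-level : ∀ k → k ≤ suc j → Above≤ n S x k (a k)
    spine-level k k≤j = ≤-trans k≤j j<n , a-above k

  hang : ∀ t s → .(Hanging S (a j) (a (suc j)) t s) → State T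
  hang t s h = to ψ (suc t + j) s (hanging-level t s (recompute (Hanging? S _ _ t s) h))

  hang-level : ∀ t s .(h : Hanging S (a j) (a (suc j)) t s) → Hanging T (b j) (b (suc j)) t (hang t s h)
  hang-level t s h = reaches-b , avoids-b
    where
    open ≡-Reasoning
    h′ = recompute (Hanging? S _ _ t s) h

    reaches-b : iter (f T) (suc t) (hang t s h) ≡ b j
    reaches-b = begin
      iter (f T) (suc t) (hang t s h) ≡⟨ to-iter-commute ψ ψ-closed (suc t) j s _
                                           (subst (Above≤ n S x j) (sym (proj₁ h′)) a-level) ⟩
      to ψ j (iter (f S) (suc t) s) _ ≡⟨ cong-irr (to ψ) refl (proj₁ h′) _ a-level ⟩
      to ψ j (a j) _                  ≡⟨ ψ-spine j (n≤1+n j) _ ⟩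
      b j                             ∎
      where a-level = spine-level j (n≤1+n j)

    avoids-b : ¬ iter (f T) t (hang t s h) ≡ b (suc j)
    avoids-b e = proj₂ h′ (to-injective ψ (suc j) (ancestor-level t s h′) (spine-level (suc j) ≤-refl)
     (begin
      to ψ (suc j) (iter (f S) t s) _     ≡⟨ to-iter-commute ψ ψ-closed t (suc j) s
                                               (subst (λ m → Above≤ n S x m s) (sym (+-suc t j))
                                                      (hanging-level t s h′)) _ ⟨
      iter (f T) t (to ψ (t + suc j) s _) ≡⟨ cong (iter (f T) t) (cong-irr (to ψ) (+-suc t j) refl _ _) ⟩
      iter (f T) t (hang t s h)           ≡⟨ e ⟩
      b (suc j)                           ≡⟨ ψ-spine (suc j) ≤-refl _ ⟨
      to ψ (suc j) (a (suc j)) _          ∎))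

  hang-commute : ∀ t s .(h : Hanging S (a j) (a (suc j)) (suc t) s)
                       .(h′ : Hanging S (a j) (a (suc j)) t (f S s)) →
                 f T (hang (suc t) s h) ≡ hang t (f S s) h′
  hang-commute t s h h′ = to-commute ψ (suc t + j) s _ _

module TruncatedIsoSpine (n d : ℕ) {A B : FDDS} {u : State A} {v : State B}
                         (p : ℕ) (u-cycle : iter (f A) (suc p) u ≡ u)
                         (q : ℕ) (v-cycle : iter (f B) (suc q) v ≡ v)
                         (φ : LevelIso (f A) (f B) (Above≤ n A u) (Above≤ n B v))
                         (B-deep : ∀ s → Periodic B (iter (f B) d s)) where

  module SA = Spine A p u-cycle
  module SB = Spine B q v-cycle
  open SA using () renaming (spine to a)
  open SB using () renaming (spine to b)

  -- The image of c is periodic because c = f^m w with m ≥ d, and B has depth d.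
  φ-deep : ∀ m k {c} (pc : Above≤ n A u k c) → d ≤ m → m + k ≤ n →
           ∀ w → iter (f A) m w ≡ c → to φ k c pc ≡ b k
  φ-deep m k {c} pc d≤m m+k≤n w w↦c = SB.spine-unique k image-periodic (proj₂ (to-level φ k c pc))
    where
    w-level : Above≤ n A u (m + k) w
    w-level = m+k≤n , (begin
      iter (f A) (m + k) w            ≡⟨ cong (λ i → iter (f A) i w) (+-comm m k) ⟩
      iter (f A) (k + m) w            ≡⟨ iter-+ (f A) k m w ⟩
      iter (f A) k (iter (f A) m w)   ≡⟨ cong (iter (f A) k) w↦c ⟩
      iter (f A) k c                  ≡⟨ proj₂ pc ⟩
      u                               ∎)
      where open ≡-Reasoning
    image-periodic : Periodic B (to φ k c pc)
    image-periodic = subst (Periodic B)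
      (trans (to-iter-commute φ (level-closed (truncated n (above A u))) m k w w-level
                              (subst (Above≤ n A u k) (sym w↦c) pc))
             (cong-irr (to φ) refl w↦c _ _))
      (Periodic-later B d≤m (to φ (m + k) w w-level) (B-deep _))

  spine-level : ∀ k → k + d ≤ n → Above≤ n A u k (a k)
  spine-level k k+d≤n = m+n≤o⇒m≤o k k+d≤n , SA.spine-above k

  φ-spine : ∀ k → k + d ≤ n → .(pk : Above≤ n A u k (a k)) → to φ k (a k) pk ≡ b k
  φ-spine k k+d≤n _ =
    φ-deep d k (spine-level k k+d≤n) ≤-refl (subst (_≤ n) (+-comm k d) k+d≤n)
           (a (d + k)) (iter-backward (f A) a SA.spine-step d k)

  φ⁻¹-spine : ∀ k → k + d ≤ n → .(qk : Above≤ n B v k (b k)) → from φ k (b k) qk ≡ a k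
  φ⁻¹-spine k k+d≤n qk =
    trans (cong-irr (from φ) refl (sym (φ-spine k k+d≤n _)) _ _) (from-to φ k (a k) (spine-level k k+d≤n))

  hanging-bound-B : ∀ j → suc j + d ≤ n → ∀ t s → Hanging B (b j) (b (suc j)) t s → suc t + j ≤ n
  hanging-bound-B j sj+d≤n t s h with t <? d
  ... | yes t<d = ≤-trans (+-monoˡ-≤ j t<d)
                          (≤-trans (≤-reflexive (+-comm d j)) (≤-trans (n≤1+n (j + d)) sj+d≤n))
  ... | no t≮d = contradiction (SB.spine-unique (suc j) (Periodic-later B (≮⇒≥ t≮d) s (B-deep s))
                                                 (trans (Hanging-ancestor j t s h) (SB.spine-above j)))
                               (proj₂ h)

  -- Otherwise φ-deep would put the ancestor of s at level suc j on the spine.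
  hanging-bound-A : ∀ j → suc j + d ≤ n → ∀ t s → Hanging A (a j) (a (suc j)) t s → suc t + j ≤ n
  hanging-bound-A j sj+d≤n t s h with suc t + j ≤? n
  ... | yes fits = fits
  ... | no too-deep = contradiction
    (to-injective φ (suc j) c-level (spine-level (suc j) sj+d≤n)
       (trans (φ-deep m (suc j) c-level d≤m (≤-reflexive (m∸n+n≡m sj≤n)) w w↦c)
              (sym (φ-spine (suc j) sj+d≤n _))))
    (proj₂ h)
    where
    sj≤n = m+n≤o⇒m≤o (suc j) sj+d≤n
    m = n ∸ suc j
    c-level : Above≤ n A u (suc j) (iter (f A) t s)
    c-level = sj≤n , trans (Hanging-ancestor j t s h) (SA.spine-above j)
    d≤m : d ≤ m
    d≤m = m+n≤o⇒m≤o∸n d (subst (_≤ n) (+-comm (suc j) d) sj+d≤n)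
    m≤t : m ≤ t
    m≤t = m≤n+o⇒m∸n≤o n (suc j)
            (≤-trans (s≤s⁻¹ (≰⇒> too-deep)) (≤-trans (≤-reflexive (+-comm t j)) (n≤1+n (j + t))))
    w = iter (f A) (t ∸ m) s
    w↦c : iter (f A) m w ≡ iter (f A) t s
    w↦c = trans (sym (iter-+ (f A) m (t ∸ m) s)) (cong (λ i → iter (f A) i s) (m+[n∸m]≡n m≤t))

  LevelIso-hanging : ∀ j → suc j + d ≤ n → spineSite A p u-cycle j ≃ʰ spineSite B q v-cycle j
  LevelIso-hanging j sj+d≤n = record
    { to = FA.hang ; from = FB.hang
    ; to-level = FA.hang-level ; from-level = FB.hang-level
    ; from-to = λ t s _ → from-to φ (suc t + j) s _
    ; to-from = λ t s _ → to-from φ (suc t + j) s _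
    ; to-commute = FA.hang-commute ; from-commute = FB.hang-commute
    }
    where
    j<n : j < n
    j<n = m+n≤o⇒m≤o (suc j) sj+d≤n
    below : ∀ {k} → k ≤ suc j → k + d ≤ n
    below k≤sj = ≤-trans (+-monoˡ-≤ d k≤sj) sj+d≤n
    module FA = HangingTransport n φ a b SA.spine-above j j<n
                                 (λ k k≤sj → φ-spine k (below k≤sj)) (hanging-bound-A j sj+d≤n)
    module FB = HangingTransport n (LevelIso-sym φ) b a SB.spine-above j j<n
                                 (λ k k≤sj → φ⁻¹-spine k (below k≤sj)) (hanging-bound-B j sj+d≤n)

truncIso⇒unrollIso : ∀ {A B : FDDS} α d n → PeriodicState A ↔ Fin α → PeriodicState B ↔ Fin α →
                     (∀ s → Periodic B (iter (f B) d s)) → 2 * α + d ≤ n → ∀ u v →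
                     truncUnrollTree n A u ≅ᵗ truncUnrollTree n B v → unrollTree A u ≅ᵗ unrollTree B v
truncIso⇒unrollIso {A} {B} α d n countA countB B-deep 2α+d≤n u@(pstate _ u-periodic) v@(pstate _ v-periodic) i
  with minimalPeriod A u-periodic | minimalPeriod B v-periodic
... | p , u-cycle , u-minimal | q , v-cycle , v-minimal =
  levelIso⇒treeIso (above A (state u)) (above B (state v))
    (LevelIso-glue SA.spine SB.spine SA.spine-step SB.spine-step hanging-isos 0)
  where
  module SA = Spine A p u-cycle
  module SB = Spine B q v-cycle
  open TruncatedIsoSpine n d p u-cycle q v-cycle (truncIso⇒levelIso n u v i) B-deep using (LevelIso-hanging)

  periods≤ : suc p + suc q ≤ 2 * α
  periods≤ = ≤-trans (+-mono-≤ (SA.period≤ u-minimal countA) (SB.period≤ v-minimal countB))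
                     (≤-reflexive (cong (α +_) (sym (+-identityʳ α))))

  hanging-isos : ∀ j → spineSite A p u-cycle j ≃ʰ spineSite B q v-cycle j
  hanging-isos = periodic-agreement ≃ʰ-isPartialEquivalence _ _ p q
    (spineSite-periodic A p u-cycle) (spineSite-periodic B q v-cycle)
    (λ j j<p+q → LevelIso-hanging j (≤-trans (+-monoˡ-≤ d (≤-trans j<p+q periods≤)) 2α+d≤n))

lemma6 : (A B : FDDS) (α d n : ℕ) →
         Fin α ↔ PeriodicState B →
         IsDepth B d →
         2 * α + d ≤ n →
         UnrollEq A B ⇔ TruncUnrollEq n A B
lemma6 A B α d n E depth 2α+d≤n = mk⇔
  (λ U → record { σ = σ U ; iso = λ u → unrollIso⇒truncIso n u (Inverse.to (σ U) u) (iso U u) })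
  (λ T → record { σ = σ T ; iso = λ u → truncIso⇒unrollIso α d n (↔-trans (σ T) (↔-sym E)) (↔-sym E)
                                          (IsDepth⇒deep depth) 2α+d≤n u (Inverse.to (σ T) u) (iso T u) })
  where open MultisetIso
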